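{- Let $G=(V,E)$ be a finite undirected simple graph. The number of orientations of $E$ under which $G$ contains a directed cycle is at least the number of subsets $X\subseteq E$ such that the graph $(V,X)$ contains a cycle.
   Context: An orientation of $E$ assigns to each edge one of its two possible directions; there are $2^{|E|}$ orientations. -}

module Defs where

open import Data.Nat using (ℕ; zero; suc; _+_; _∸_)
open import Data.Fin using (Fin)
open import Data.Fin.Properties using () renaming (_≟_ to _≟ᶠ_)
open import Data.Bool using (Bool; true; false; _∧_; _∨_; not; if_then_else_)
open import Data.List using (List; []; _∷_; _++_; [_]; map; concatMap; allFin; length; filterᵇ; upTo)
open import Data.Bool.ListAction using (any)
open import Data.Vec using (Vec; lookup) renaming ([] to []ᵥ; _∷_ to _∷ᵥ_)
open import Data.Product using (_×_; _,_; proj₁; proj₂)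
open import Relation.Nullary.Decidable using (⌊_⌋)

-- A finite simple graph on vertex set V = Fin n with edge set E = Fin m;
-- edge e has endpoints  ends e = (u , v)  (its stored "reference" direction).

IsSimple : {n m : ℕ} → (Fin m → Fin n × Fin n) → Set
IsSimple {n} {m} ends =
  ((e : Fin m) → proj₁ (ends e) ≡ proj₂ (ends e) → ⊥)
  × ((e e' : Fin m) →
       ((proj₁ (ends e) ≡ proj₁ (ends e') × proj₂ (ends e) ≡ proj₂ (ends e'))
        ⊎ (proj₁ (ends e) ≡ proj₂ (ends e') × proj₂ (ends e) ≡ proj₁ (ends e')))
       → e ≡ e')
  where
  open import Relation.Binary.PropositionalEquality using (_≡_)
  open import Data.Empty using (⊥)
  open import Data.Sum using (_⊎_)

_==_ : {n : ℕ} → Fin n → Fin n → Bool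
x == y = ⌊ x ≟ᶠ y ⌋

allLists : (n k : ℕ) → List (List (Fin n))
allLists n zero    = [] ∷ []
allLists n (suc k) = concatMap (λ v → map (v ∷_) (allLists n k)) (allFin n)

-- All vectors of Booleans of length m (= all subsets of E, resp. all orientations of E).
allBoolVecs : (m : ℕ) → List (Vec Bool m)
allBoolVecs zero    = []ᵥ ∷ []
allBoolVecs (suc m) = concatMap (λ b → map (b ∷ᵥ_) (allBoolVecs m)) (true ∷ false ∷ [])

countTrue : {A : Set} → (A → Bool) → List A → ℕ
countTrue p xs = length (filterᵇ p xs)

distinct : {n : ℕ} → List (Fin n) → Bool
distinct []       = true
distinct (x ∷ xs) = not (any (x ==_) xs) ∧ distinct xs

chain : {n : ℕ} → (Fin n → Fin n → Bool) → List (Fin n) → Bool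
chain R []           = true
chain R (x ∷ [])     = true
chain R (x ∷ y ∷ xs) = R x y ∧ chain R (y ∷ xs)

closed : {n : ℕ} → (Fin n → Fin n → Bool) → List (Fin n) → Bool
closed R []       = false
closed R (v ∷ vs) = chain R ((v ∷ vs) ++ [ v ])

hasCycleOfLen≥ : (n minLen : ℕ) → (Fin n → Fin n → Bool) → Bool
hasCycleOfLen≥ n minLen R =
  any (λ j → any (λ vs → distinct vs ∧ closed R vs) (allLists n (minLen + j)))
      (upTo (suc (n ∸ minLen)))

-- Undirected adjacency in the spanning subgraph (V, X), X ⊆ E given as a Boolean vector.
adjIn : {n m : ℕ} → (Fin m → Fin n × Fin n) → Vec Bool m → Fin n → Fin n → Bool
adjIn {m = m} ends X u v =
  any (λ e → lookup X e ∧
              ((proj₁ (ends e) == u ∧ proj₂ (ends e) == v) ∨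
               (proj₁ (ends e) == v ∧ proj₂ (ends e) == u)))
      (allFin m)

-- Arcs of the orientation o: o e = true orients e = (u , v) as u → v,
-- o e = false orients it as v → u.
arcIn : {n m : ℕ} → (Fin m → Fin n × Fin n) → Vec Bool m → Fin n → Fin n → Bool
arcIn {m = m} ends o u v =
  any (λ e → (lookup o e ∧ proj₁ (ends e) == u ∧ proj₂ (ends e) == v) ∨
              (not (lookup o e) ∧ proj₁ (ends e) == v ∧ proj₂ (ends e) == u))
      (allFin m)

hasCycle : {n m : ℕ} → (Fin m → Fin n × Fin n) → Vec Bool m → Bool
hasCycle {n} ends X = hasCycleOfLen≥ n 3 (adjIn ends X)

hasDirectedCycle : {n m : ℕ} → (Fin m → Fin n × Fin n) → Vec Bool m → Bool
hasDirectedCycle {n} ends o = hasCycleOfLen≥ n 1 (arcIn ends o)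

-- Deletion–contraction on the first edge e = uv.  An acyclic orientation of G restricts to one of G ∖ e,
-- and if both directions of e extend an orientation o of G ∖ e acyclically, then e is not a loop and o is
-- acyclic on G / e: a directed cycle of G / e lifts to a directed cycle of G through e in one of its two
-- directions.  So a(G) ≤ a(G ∖ e) + a(G / e) for the number a of acyclic orientations.  The sets X ⊆ E
-- whose edges never become loops when they are contracted (and the other edges deleted) one at a time
-- satisfy the same recursion with equality, so they are at least as many as the acyclic orientations;
-- and they contain no cycle, since a closed trail in X survives deletion and contraction until it becomes
-- a loop.  Taking complements among the 2^|E| subsets and orientations gives the theorem.

module Submission where

open import Defs
open import Data.Bool using (Bool; true; false; T; not; _∧_; _∨_)
open import Data.Bool.Properties using (T-∧; T-∨)
open import Data.Bool.ListAction using (any)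
open import Data.Empty using (⊥-elim)
open import Data.Fin using (Fin; zero; suc) renaming (_<_ to _<ᶠ_)
open import Data.Vec using (Vec) renaming ([] to []ᵥ; _∷_ to _∷ᵥ_; lookup to lookupᵥ)
open import Data.Fin.Properties using (_≟_; pigeonhole)
open import Data.List using (List; []; _∷_; _++_; [_]; map; allFin; length; upTo; lookup; filterᵇ)
open import Data.List.Membership.Propositional using (_∈_; _∉_; find; lose)
open import Data.List.Membership.Propositional.Properties
  using (∈-allFin; ∈-upTo⁺; ∈-++⁻; ∈-lookup; ∈-map⁺; ∈-map⁻; ∈-concatMap⁺; ∈-concatMap⁻;
         ∈-∃++)
open import Data.List.Properties using (++-assoc; ++-identityʳ; length-++; filter-++)
open import Data.List.Relation.Unary.Any using (here; there; any?)
open import Data.List.Relation.Unary.All using (All; []; _∷_)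
import Data.List.Relation.Unary.All as All
open import Data.List.Relation.Unary.AllPairs using ([]; _∷_)
open import Data.List.Relation.Unary.Unique.Propositional using (Unique)
open import Data.List.Relation.Unary.Any.Properties using (any⁺; any⁻)
open import Data.Nat using (ℕ; zero; suc; _+_; _∸_; _≤_; _<_; z≤n; s≤s; _≤?_)
open import Data.Nat.Properties
  using (module ≤-Reasoning; ≤-refl; ≤-trans; ≤-pred; ≰⇒>; m≤m+n; m≤n+m; m<m+n; m≤n⇒m≤1+n; +-suc;
         +-mono-≤; +-monoʳ-≤; +-cancelʳ-≤; ∸-monoˡ-≤; m+[n∸m]≡n; +-commutativeSemigroup)
open import Algebra.Properties.CommutativeSemigroup +-commutativeSemigroup using (interchange)
open import Data.Product using (_×_; _,_; proj₁; proj₂; ∃₂; ∃-syntax; swap)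
import Data.Product as Product
open import Data.Sum using (_⊎_; inj₁; inj₂)
import Data.Sum as Sum
open import Function using (_∘_; id; Equivalence)
open import Level using (0ℓ)
open import Relation.Binary.Core using (Rel; _⇒_)
open import Relation.Binary.Construct.Union using (_∪_)
open import Relation.Binary.Construct.Closure.ReflexiveTransitive using (Star; ε; _◅_; _◅◅_)
import Relation.Binary.Construct.Closure.ReflexiveTransitive as Star
open import Relation.Binary.PropositionalEquality hiding ([_])
open import Relation.Nullary using (¬_; yes; no)
open import Relation.Nullary.Decidable using (toWitness; fromWitness; T?)

open Equivalence using (to; from)

T-not⁻ : ∀ {b} → T (not b) → ¬ T b
T-not⁻ {false} _ ()

T-not⁺ : ∀ {b} → ¬ T b → T (not b)
T-not⁺ {false} _ = _
T-not⁺ {true} ¬t = ¬t _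

==⇒≡ : {n : ℕ} {x y : Fin n} → T (x == y) → x ≡ y
==⇒≡ {x = x} {y} = toWitness {a? = x ≟ y}

==-refl : {n : ℕ} (x : Fin n) → T (x == x)
==-refl x = fromWitness {a? = x ≟ x} refl

≡⇒== : {n : ℕ} {x y : Fin n} → x ≡ y → T (x == y)
≡⇒== {x = x} refl = ==-refl x

module _ {n : ℕ} (x : Fin n) (xs : List (Fin n)) where

  distinct-head : T (distinct (x ∷ xs)) → x ∉ xs
  distinct-head d x∈xs = T-not⁻ (proj₁ (to T-∧ d)) (any⁺ _ (lose x∈xs (==-refl x)))

  distinct-tail : T (distinct (x ∷ xs)) → T (distinct xs)
  distinct-tail d = proj₂ (to T-∧ d)

module _ {n : ℕ} {x : Fin n} {xs : List (Fin n)} where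

  distinct-∷ : x ∉ xs → T (distinct xs) → T (distinct (x ∷ xs))
  distinct-∷ x∉xs d = from T-∧ (T-not⁺ (x∉xs ∘ found) , d)
    where
    found : T (any (x ==_) xs) → x ∈ xs
    found h with y , y∈xs , x=y ← find (any⁻ _ xs h) = subst (_∈ xs) (sym (==⇒≡ x=y)) y∈xs

distinct-∷ʳ : {n : ℕ} {x : Fin n} (xs : List (Fin n)) → T (distinct xs) → x ∉ xs →
              T (distinct (xs ++ [ x ]))
distinct-∷ʳ [] _ _ = _
distinct-∷ʳ {x = x} (y ∷ ys) d x∉ =
  distinct-∷ y∉ (distinct-∷ʳ ys (distinct-tail y ys d) (x∉ ∘ there))
  where
  y∉ : y ∉ ys ++ [ x ]
  y∉ y∈ with ∈-++⁻ ys y∈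
  ... | inj₁ y∈ys = distinct-head y ys d y∈ys
  ... | inj₂ (here refl) = x∉ (here refl)

module _ {n : ℕ} where

  distinct-lookup : ∀ (vs : List (Fin n)) {i j} → T (distinct vs) → i <ᶠ j → lookup vs i ≢ lookup vs j
  distinct-lookup (v ∷ vs) {zero} {suc j} d _ eq =
    distinct-head v vs d (subst (_∈ vs) (sym eq) (∈-lookup {xs = vs} j))
  distinct-lookup (v ∷ vs) {suc i} {suc j} d (s≤s i<j) = distinct-lookup vs (distinct-tail v vs d) i<j

  distinct⇒length≤ : ∀ (vs : List (Fin n)) → T (distinct vs) → length vs ≤ n
  distinct⇒length≤ vs d with length vs ≤? n
  ... | yes ≤n = ≤n
  ... | no ≰n with i , j , i<j , eq ← pigeonhole (≰⇒> ≰n) (lookup vs) =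
    ⊥-elim (distinct-lookup vs d i<j eq)

  repeated-vertex : ∀ (vs : List (Fin n)) → ¬ T (distinct vs) →
                    ∃[ as ] ∃[ y ] ∃[ bs ] ∃[ cs ] vs ≡ as ++ y ∷ bs ++ y ∷ cs
  repeated-vertex [] nd = ⊥-elim (nd _)
  repeated-vertex (x ∷ xs) nd with any? (x ≟_) xs
  ... | yes x∈xs with bs , cs , refl ← ∈-∃++ {v = x} {xs = xs} x∈xs = [] , x , bs , cs , refl
  ... | no x∉xs with as , y , bs , cs , refl ← repeated-vertex xs (nd ∘ distinct-∷ x∉xs) =
    x ∷ as , y , bs , cs , refl

  ∈-allLists : ∀ (vs : List (Fin n)) → vs ∈ allLists n (length vs)
  ∈-allLists [] = here refl
  ∈-allLists (v ∷ vs) = ∈-concatMap⁺ _ (lose (∈-allFin v) (∈-map⁺ (v ∷_) (∈-allLists vs)))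

  ∈-allLists⁻ : ∀ k {vs : List (Fin n)} → vs ∈ allLists n k → length vs ≡ k
  ∈-allLists⁻ zero (here refl) = refl
  ∈-allLists⁻ (suc k) vs∈
    with v , _ , vs∈′ ← find (∈-concatMap⁻ _ {xs = allFin n} vs∈)
    with ws , ws∈ , refl ← ∈-map⁻ (v ∷_) vs∈′ = cong suc (∈-allLists⁻ k ws∈)

  distinctClosed : (Fin n → Fin n → Bool) → List (Fin n) → Bool
  distinctClosed R vs = distinct vs ∧ closed R vs

  hasCycleOfLen≥⁻ : ∀ k R → T (hasCycleOfLen≥ n k R) →
                    ∃[ vs ] k ≤ length vs × T (distinct vs) × T (closed R vs)
  hasCycleOfLen≥⁻ k R h
    with j , _ , h′ ← find (any⁻ (λ j → any (distinctClosed R) (allLists n (k + j)))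
                                 (upTo (suc (n ∸ k))) h)
    with vs , vs∈ , dc ← find (any⁻ (distinctClosed R) _ h′) =
    vs , subst (k ≤_) (sym (∈-allLists⁻ (k + j) vs∈)) (m≤m+n k j) , to T-∧ dc

  hasCycleOfLen≥⁺ : ∀ k R (vs : List (Fin n)) → k ≤ length vs → T (distinct vs) → T (closed R vs) →
                    T (hasCycleOfLen≥ n k R)
  hasCycleOfLen≥⁺ k R vs k≤ d c =
    any⁺ _ (lose (∈-upTo⁺ (s≤s (∸-monoˡ-≤ k (distinct⇒length≤ vs d))))
           (any⁺ (distinctClosed R) (lose vs∈ (from T-∧ (d , c)))))
    where
    vs∈ : vs ∈ allLists n (k + (length vs ∸ k))
    vs∈ = subst (λ l → vs ∈ allLists n l) (sym (m+[n∸m]≡n k≤)) (∈-allLists vs)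

Cyclic : {A : Set} → Rel A 0ℓ → Set
Cyclic R = ∃₂ λ x y → R x y × Star R y x

cyclic-map : {A : Set} {R S : Rel A 0ℓ} → R ⇒ S → Cyclic R → Cyclic S
cyclic-map f (x , y , r , s) = x , y , f r , Star.map f s

T₂ : {A : Set} → (A → A → Bool) → Rel A 0ℓ
T₂ R x y = T (R x y)

module _ {n : ℕ} (R : Fin n → Fin n → Bool) where

  chain-++⁻ˡ : ∀ xs ys → T (chain R (xs ++ ys)) → T (chain R xs)
  chain-++⁻ˡ [] ys h = _
  chain-++⁻ˡ (x ∷ []) ys h = _
  chain-++⁻ˡ (x ∷ x′ ∷ xs) ys h =
    let r , h′ = to T-∧ h in from T-∧ (r , chain-++⁻ˡ (x′ ∷ xs) ys h′)

  chain-++⁻ʳ : ∀ xs ys → T (chain R (xs ++ ys)) → T (chain R ys)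
  chain-++⁻ʳ [] ys h = h
  chain-++⁻ʳ (x ∷ []) [] h = _
  chain-++⁻ʳ (x ∷ []) (y ∷ ys) h = proj₂ (to T-∧ h)
  chain-++⁻ʳ (x ∷ x′ ∷ xs) ys h = chain-++⁻ʳ (x′ ∷ xs) ys (proj₂ (to (T-∧ {R x x′}) h))

  closed⇒chain : ∀ vs → T (closed R vs) → T (chain R vs)
  closed⇒chain (v ∷ vs) = chain-++⁻ˡ (v ∷ vs) [ v ]

  chain-repeat : ∀ as y bs cs → T (chain R (as ++ y ∷ bs ++ y ∷ cs)) → T (closed R (y ∷ bs))
  chain-repeat as y bs cs h =
    chain-++⁻ˡ (y ∷ bs ++ [ y ]) cs
      (subst (T ∘ chain R) (cong (y ∷_) (sym (++-assoc bs [ y ] cs))) (chain-++⁻ʳ as _ h))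

  chain⇒Star : ∀ x ys z → T (chain R (x ∷ ys ++ [ z ])) → Star (T₂ R) x z
  chain⇒Star x [] z h = proj₁ (to T-∧ h) ◅ ε
  chain⇒Star x (y ∷ ys) z h = let r , h′ = to T-∧ h in r ◅ chain⇒Star y ys z h′

  Star⇒chain : ∀ {x y z} → T (R x y) → Star (T₂ R) y z → ∃[ ys ] T (chain R (x ∷ ys ++ [ z ]))
  Star⇒chain r ε = [] , from T-∧ (r , _)
  Star⇒chain r (r′ ◅ s) with ys , h ← Star⇒chain r′ s = _ ∷ ys , from T-∧ (r , h)

  closed⇒cyclic : ∀ vs → T (closed R vs) → Cyclic (T₂ R)
  closed⇒cyclic (v ∷ []) h = v , v , proj₁ (to T-∧ h) , ε
  closed⇒cyclic (v ∷ w ∷ ws) h = let r , h′ = to T-∧ h in v , w , r , chain⇒Star w ws v h′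

  length-repeat : ∀ as (y : Fin n) bs cs → 2 + length bs ≤ length (as ++ y ∷ bs ++ y ∷ cs)
  length-repeat [] y bs cs =
    s≤s (subst (suc (length bs) ≤_) (sym (length-++ bs)) (m<m+n (length bs) (s≤s z≤n)))
  length-repeat (a ∷ as) y bs cs = m≤n⇒m≤1+n (length-repeat as y bs cs)

  closed⇒distinct-closed : ∀ vs → T (closed R vs) → ∃[ ws ] T (distinct ws) × T (closed R ws)
  closed⇒distinct-closed vs = shorten (suc (length vs)) vs (s≤s ≤-refl)
    where
    shorten : ∀ k vs → length vs < k → T (closed R vs) → ∃[ ws ] T (distinct ws) × T (closed R ws)
    shorten (suc k) vs <k c with T? (distinct vs)
    ... | yes d = vs , d , c
    ... | no ¬d with as , y , bs , cs , refl ← repeated-vertex vs ¬d =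
      shorten k (y ∷ bs) (≤-trans (length-repeat as y bs cs) (≤-pred <k))
        (chain-repeat as y bs cs (closed⇒chain vs c))

  closed⇒nonempty : ∀ vs → T (closed R vs) → 1 ≤ length vs
  closed⇒nonempty (v ∷ vs) _ = s≤s z≤n

  hasCycleOfLen≥1⇒cyclic : T (hasCycleOfLen≥ n 1 R) → Cyclic (T₂ R)
  hasCycleOfLen≥1⇒cyclic h with vs , _ , _ , c ← hasCycleOfLen≥⁻ 1 R h = closed⇒cyclic vs c

  cyclic⇒hasCycleOfLen≥1 : Cyclic (T₂ R) → T (hasCycleOfLen≥ n 1 R)
  cyclic⇒hasCycleOfLen≥1 (x , y , r , s)
    with vs , c ← Star⇒chain r s
    with ws , d , c′ ← closed⇒distinct-closed (x ∷ vs) c =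
    hasCycleOfLen≥⁺ 1 R ws (closed⇒nonempty ws c′) d c′

-- Cycles through a contracted pair of vertices

_↦_ : {A : Set} → A → A → Rel A 0ℓ
(a ↦ b) x y = x ≡ a × y ≡ b

_⇄_ : {A : Set} → A → A → Rel A 0ℓ
a ⇄ b = (a ↦ b) ∪ (b ↦ a)

module _ {A : Set} (D : Rel A 0ℓ) where

  split-at-jump : ∀ {a b x y} → Star (D ∪ (a ↦ b)) x y →
                  Star D x y ⊎ (Star D x a × Star (D ∪ (a ↦ b)) b y)
  split-at-jump ε = inj₁ ε
  split-at-jump (inj₂ (refl , refl) ◅ s) = inj₂ (ε , s)
  split-at-jump (inj₁ d ◅ s) with split-at-jump s
  ... | inj₁ s′ = inj₁ (d ◅ s′)
  ... | inj₂ (s₁ , s₂) = inj₂ (d ◅ s₁ , s₂)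

  prepend-jump : ∀ {a b y} → Star (D ∪ (b ↦ a)) b y →
                 Cyclic D ⊎ Star (D ∪ (a ↦ b)) a y ⊎ Star (D ∪ (b ↦ a)) a y
  prepend-jump w with split-at-jump w
  ... | inj₁ s = inj₂ (inj₁ (inj₂ (refl , refl) ◅ Star.map inj₁ s))
  ... | inj₂ (ε , s) = inj₂ (inj₂ s)
  ... | inj₂ (d ◅ s , _) = inj₁ (_ , _ , d , s)

  one-way-or-cyclic : ∀ {u v x y} → Star (D ∪ (u ⇄ v)) x y →
                      Cyclic D ⊎ Star (D ∪ (u ↦ v)) x y ⊎ Star (D ∪ (v ↦ u)) x y
  one-way-or-cyclic ε = inj₂ (inj₁ ε)
  one-way-or-cyclic (s ◅ w) with one-way-or-cyclic w
  ... | inj₁ c = inj₁ c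
  one-way-or-cyclic (inj₁ d ◅ w) | inj₂ w′ = inj₂ (Sum.map (inj₁ d ◅_) (inj₁ d ◅_) w′)
  one-way-or-cyclic (inj₂ (inj₁ j) ◅ w) | inj₂ (inj₁ w′) = inj₂ (inj₁ (inj₂ j ◅ w′))
  one-way-or-cyclic (inj₂ (inj₁ (refl , refl)) ◅ w) | inj₂ (inj₂ w′) = prepend-jump w′
  one-way-or-cyclic (inj₂ (inj₂ j) ◅ w) | inj₂ (inj₂ w′) = inj₂ (inj₂ (inj₂ j ◅ w′))
  one-way-or-cyclic (inj₂ (inj₂ (refl , refl)) ◅ w) | inj₂ (inj₁ w′) =
    Sum.map₂ Sum.swap (prepend-jump w′)

  closed-walk⇒cyclic : ∀ {u v x y} → D x y → Star (D ∪ (u ⇄ v)) y x →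
                       Cyclic (D ∪ (u ↦ v)) ⊎ Cyclic (D ∪ (v ↦ u))
  closed-walk⇒cyclic d w with one-way-or-cyclic w
  ... | inj₁ c = inj₁ (cyclic-map inj₁ c)
  ... | inj₂ (inj₁ w′) = inj₁ (_ , _ , inj₁ d , w′)
  ... | inj₂ (inj₂ w′) = inj₂ (_ , _ , inj₁ d , w′)

Image : {A : Set} → (A → A) → Rel A 0ℓ → Rel A 0ℓ
Image r D p q = ∃₂ λ x y → D x y × r x ≡ p × r y ≡ q

-- Consecutive arcs of a walk in the image meet in two points that are equal or form the pair u , v.
module _ {A : Set} {D : Rel A 0ℓ} {u v : A} (r : A → A)
         (r-merges : ∀ {x y} → r x ≡ r y → x ≡ y ⊎ (u ⇄ v) x y) where

  lift-walk : ∀ {p q x} → Star (Image r D) p q → r x ≡ p →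
              ∃[ y ] r y ≡ q × Star (D ∪ (u ⇄ v)) x y
  lift-walk ε rx = _ , rx , ε
  lift-walk ((x₀ , y₀ , d , rx₀ , ry₀) ◅ s) rx
    with y , ry , w ← lift-walk s ry₀
    with r-merges (trans rx (sym rx₀))
  ... | inj₁ refl = y , ry , inj₁ d ◅ w
  ... | inj₂ j = y , ry , inj₂ j ◅ inj₁ d ◅ w

  cyclic-image : Cyclic (Image r D) → Cyclic (D ∪ (u ↦ v)) ⊎ Cyclic (D ∪ (v ↦ u))
  cyclic-image (_ , _ , (x₀ , y₀ , d , rx₀ , ry₀) , s)
    with y , ry , w ← lift-walk s ry₀
    with r-merges (trans ry (sym rx₀))
  ... | inj₁ refl = closed-walk⇒cyclic D d w
  ... | inj₂ j = closed-walk⇒cyclic D d (w ◅◅ (inj₂ j ◅ ε))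

-- Orientations, deletion and contraction

orient : {A : Set} → Bool → A × A → A × A
orient true  = id
orient false = swap

orient-map : {A : Set} (f : A → A) (b : Bool) (uv : A × A) →
             orient b (Product.map f f uv) ≡ Product.map f f (orient b uv)
orient-map f true  uv = refl
orient-map f false uv = refl

module _ {n : ℕ} where

  merge : Fin n → Fin n → Fin n → Fin n
  merge u v x with x ≟ v
  ... | yes _ = u
  ... | no  _ = x

  merge-only : ∀ {u v x y} → merge u v x ≡ merge u v y → x ≡ y ⊎ (u ⇄ v) x y
  merge-only {u} {v} {x} {y} eq with x ≟ v | y ≟ v
  ... | yes refl | yes refl = inj₁ refl
  ... | yes refl | no  _    = inj₂ (inj₂ (refl , sym eq))
  ... | no  _    | yes refl = inj₂ (inj₁ (eq , refl))
  ... | no  _    | no  _    = inj₁ eq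

  merge-merges : ∀ u v → merge u v u ≡ merge u v v
  merge-merges u v with u ≟ v | v ≟ v
  ... | yes _ | yes _ = refl
  ... | no  _ | yes _ = refl
  ... | _     | no v≢v = ⊥-elim (v≢v refl)

  orient-== : ∀ (b : Bool) (uv : Fin n × Fin n) {x y} →
    T ((b ∧ proj₁ uv == x ∧ proj₂ uv == y) ∨ (not b ∧ proj₁ uv == y ∧ proj₂ uv == x)) →
    orient b uv ≡ (x , y)
  orient-== true uv h with to T-∨ h
  ... | inj₁ h′ = let p , q = to T-∧ h′ in cong₂ _,_ (==⇒≡ p) (==⇒≡ q)
  orient-== false uv h = let p , q = to T-∧ h in cong₂ _,_ (==⇒≡ q) (==⇒≡ p)

  orient-==⁻ : ∀ (b : Bool) (uv : Fin n × Fin n) {x y} → orient b uv ≡ (x , y) →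
    T ((b ∧ proj₁ uv == x ∧ proj₂ uv == y) ∨ (not b ∧ proj₁ uv == y ∧ proj₂ uv == x))
  orient-==⁻ true  (x , y) refl = from T-∨ (inj₁ (from T-∧ (==-refl x , ==-refl y)))
  orient-==⁻ false (x , y) refl = from T-∧ (==-refl x , ==-refl y)

module _ {n m : ℕ} where

  Arc : (Fin m → Fin n × Fin n) → Vec Bool m → Rel (Fin n) 0ℓ
  Arc ends o x y = ∃[ e ] orient (lookupᵥ o e) (ends e) ≡ (x , y)

  arcIn⇒Arc : ∀ ends o → T₂ (arcIn ends o) ⇒ Arc ends o
  arcIn⇒Arc ends o h with e , _ , h′ ← find (any⁻ _ (allFin m) h) =
    e , orient-== (lookupᵥ o e) (ends e) h′

  Arc⇒arcIn : ∀ ends o → Arc ends o ⇒ T₂ (arcIn ends o)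
  Arc⇒arcIn ends o (e , eq) = any⁺ _ (lose (∈-allFin e) (orient-==⁻ (lookupᵥ o e) (ends e) eq))

  directedCycle⇒cyclic : ∀ ends o → T (hasDirectedCycle ends o) → Cyclic (Arc ends o)
  directedCycle⇒cyclic ends o = cyclic-map (arcIn⇒Arc ends o) ∘ hasCycleOfLen≥1⇒cyclic (arcIn ends o)

  cyclic⇒directedCycle : ∀ ends o → Cyclic (Arc ends o) → T (hasDirectedCycle ends o)
  cyclic⇒directedCycle ends o = cyclic⇒hasCycleOfLen≥1 (arcIn ends o) ∘ cyclic-map (Arc⇒arcIn ends o)

acyclic : {n m : ℕ} → (Fin m → Fin n × Fin n) → Vec Bool m → Bool
acyclic ends o = not (hasDirectedCycle ends o)

contract : {n m : ℕ} → (Fin (suc m) → Fin n × Fin n) → Fin m → Fin n × Fin n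
contract ends e = let (u , v) = ends zero in Product.map (merge u v) (merge u v) (ends (suc e))

module _ {n m : ℕ} (ends : Fin (suc m) → Fin n × Fin n) (o : Vec Bool m) where

  private
    u v : Fin n
    u = proj₁ (ends zero)
    v = proj₂ (ends zero)

  cyclic-deletion : ∀ b → Cyclic (Arc (ends ∘ suc) o) → Cyclic (Arc ends (b ∷ᵥ o))
  cyclic-deletion b = cyclic-map λ (e , eq) → suc e , eq

  cyclic-loop : ∀ b → u ≡ v → Cyclic (Arc ends (b ∷ᵥ o))
  cyclic-loop true  u≡v = u , u , (zero , cong (u ,_) (sym u≡v)) , ε
  cyclic-loop false u≡v = v , v , (zero , cong (v ,_) u≡v) , ε

  cyclic-contraction : Cyclic (Arc (contract ends) o) →
                       Cyclic (Arc ends (true ∷ᵥ o)) ⊎ Cyclic (Arc ends (false ∷ᵥ o))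
  cyclic-contraction =
    Sum.map (cyclic-map forward) (cyclic-map backward)
    ∘ cyclic-image (merge u v) merge-only
    ∘ cyclic-map preimage
    where
    preimage : Arc (contract ends) o ⇒ Image (merge u v) (Arc (ends ∘ suc) o)
    preimage (e , eq) =
      let eq′ = trans (sym (orient-map (merge u v) (lookupᵥ o e) (ends (suc e)))) eq
      in _ , _ , (e , refl) , cong proj₁ eq′ , cong proj₂ eq′
    forward : Arc (ends ∘ suc) o ∪ (u ↦ v) ⇒ Arc ends (true ∷ᵥ o)
    forward (inj₁ (e , eq)) = suc e , eq
    forward (inj₂ (refl , refl)) = zero , refl
    backward : Arc (ends ∘ suc) o ∪ (v ↦ u) ⇒ Arc ends (false ∷ᵥ o)
    backward (inj₁ (e , eq)) = suc e , eq
    backward (inj₂ (refl , refl)) = zero , refl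

  private
    cyclic⇒¬acyclic : ∀ b → Cyclic (Arc ends (b ∷ᵥ o)) → ¬ T (acyclic ends (b ∷ᵥ o))
    cyclic⇒¬acyclic b c h = T-not⁻ h (cyclic⇒directedCycle ends (b ∷ᵥ o) c)

  acyclic-deletion : ∀ b → T (acyclic ends (b ∷ᵥ o)) → T (acyclic (ends ∘ suc) o)
  acyclic-deletion b h =
    T-not⁺ (λ c → cyclic⇒¬acyclic b (cyclic-deletion b (directedCycle⇒cyclic (ends ∘ suc) o c)) h)

  acyclic-contraction : T (acyclic ends (true ∷ᵥ o)) → T (acyclic ends (false ∷ᵥ o)) →
                        T (not (u == v) ∧ acyclic (contract ends) o)
  acyclic-contraction h₁ h₂ = from T-∧
    ( T-not⁺ (λ loop → cyclic⇒¬acyclic true (cyclic-loop true (==⇒≡ loop)) h₁)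
    , T-not⁺ (λ c → Sum.[ (λ c₁ → cyclic⇒¬acyclic true c₁ h₁) , (λ c₂ → cyclic⇒¬acyclic false c₂ h₂) ]
                         (cyclic-contraction (directedCycle⇒cyclic (contract ends) o c))) )

-- Trails and forests

Joins : {A : Set} → A × A → Rel A 0ℓ
Joins uv x y = uv ≡ (x , y) ⊎ uv ≡ (y , x)

module _ {A : Set} {uv : A × A} where

  joins-sym : ∀ {x y} → Joins uv x y → Joins uv y x
  joins-sym = Sum.swap

  joins-twice : ∀ {a b c} → Joins uv a b → Joins uv b c → a ≡ c
  joins-twice (inj₁ refl) (inj₁ refl) = refl
  joins-twice (inj₁ refl) (inj₂ refl) = refl
  joins-twice (inj₂ refl) (inj₁ refl) = refl
  joins-twice (inj₂ refl) (inj₂ refl) = refl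

  joins-loop : ∀ {x} → Joins uv x x → proj₁ uv ≡ proj₂ uv
  joins-loop (inj₁ refl) = refl
  joins-loop (inj₂ refl) = refl

  joins-map : ∀ (f : A → A) {x y} → Joins uv x y → Joins (Product.map f f uv) (f x) (f y)
  joins-map f = Sum.map (cong (Product.map f f)) (cong (Product.map f f))

joins-merge : ∀ {n} {uv : Fin n × Fin n} {x y} → Joins uv x y →
              merge (proj₁ uv) (proj₂ uv) x ≡ merge (proj₁ uv) (proj₂ uv) y
joins-merge {x = x} {y} (inj₁ refl) = merge-merges x y
joins-merge {x = x} {y} (inj₂ refl) = sym (merge-merges y x)

module _ {n m : ℕ} (ends : Fin m → Fin n × Fin n) (X : Vec Bool m) where

  data Walk : Fin n → Fin n → List (Fin m) → Set where
    []   : ∀ {x} → Walk x x []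
    step : ∀ {x y z es} e → T (lookupᵥ X e) → Joins (ends e) x y → Walk y z es → Walk x z (e ∷ es)

  ClosedTrail : Set
  ClosedTrail = ∃₂ λ x es → Walk x x es × Unique es × es ≢ []

  adjIn⇒joins : ∀ {x y} → T (adjIn ends X x y) → ∃[ e ] T (lookupᵥ X e) × Joins (ends e) x y
  adjIn⇒joins h with e , _ , h′ ← find (any⁻ _ (allFin m) h) with Xe , j ← to T-∧ h′ =
    e , Xe , Sum.map pair pair (to T-∨ j)
    where
    pair : ∀ {a b x y : Fin n} → T (a == x ∧ b == y) → (a , b) ≡ (x , y)
    pair h with p , q ← to T-∧ h = cong₂ _,_ (==⇒≡ p) (==⇒≡ q)

  EndsIn : List (Fin n) → Fin m → Set
  EndsIn S e = proj₁ (ends e) ∈ S × proj₂ (ends e) ∈ S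

  joins-endsIn : ∀ {S e x y} → Joins (ends e) x y → x ∈ S → y ∈ S → EndsIn S e
  joins-endsIn (inj₁ refl) x∈S y∈S = x∈S , y∈S
  joins-endsIn (inj₂ refl) x∈S y∈S = y∈S , x∈S

  joins-avoids : ∀ {S e x y es} → x ∉ S → Joins (ends e) x y → All (EndsIn S) es → All (e ≢_) es
  joins-avoids {S} x∉S j = All.map avoid
    where
    avoid : ∀ {e′} → EndsIn S e′ → _ ≢ e′
    avoid (p , q) refl = Sum.[ (λ eq → x∉S (subst (_∈ S) (cong proj₁ eq) p))
                             , (λ eq → x∉S (subst (_∈ S) (cong proj₂ eq) q)) ] j

  path⇒trail : ∀ x L z → T (distinct (x ∷ L ++ [ z ])) → T (chain (adjIn ends X) (x ∷ L ++ [ z ])) →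
               ∃[ es ] Walk x z es × Unique es × All (EndsIn (x ∷ L ++ [ z ])) es
  path⇒trail x [] z d c with e , Xe , j ← adjIn⇒joins (proj₁ (to T-∧ c)) =
    e ∷ [] , step e Xe j [] , [] ∷ [] , joins-endsIn j (here refl) (there (here refl)) ∷ []
  path⇒trail x (y ∷ L) z d c
    with adj , c′ ← to T-∧ c
    with e , Xe , j ← adjIn⇒joins adj
    with es , w , u , ends∈ ← path⇒trail y L z (distinct-tail x (y ∷ L ++ [ z ]) d) c′ =
    e ∷ es , step e Xe j w , joins-avoids (distinct-head x (y ∷ L ++ [ z ]) d) j ends∈ ∷ u ,
    joins-endsIn j (here refl) (there (here refl)) ∷ All.map (Product.map there there) ends∈

  distinct-closed⇒closedTrail : ∀ a b c rest → T (distinct (a ∷ b ∷ c ∷ rest)) →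
                                T (closed (adjIn ends X) (a ∷ b ∷ c ∷ rest)) → ClosedTrail
  distinct-closed⇒closedTrail a b c rest d cl =
    let adj-ab , cl′ = to T-∧ cl
        adj-bc , cl″ = to T-∧ cl′
        e₀ , Xe₀ , j₀ = adjIn⇒joins adj-ab
        e₁ , Xe₁ , j₁ = adjIn⇒joins adj-bc
        es , w , u , ends∈ = path⇒trail c rest a (distinct-∷ʳ (c ∷ rest) dᶜ a∉) cl″
        -- The only place where the cycle needs length at least 3 (a ≢ c).
        e₀≢e₁ : e₀ ≢ e₁
        e₀≢e₁ eq = a∉ (here (joins-twice j₀ (subst (λ e → Joins (ends e) b c) (sym eq) j₁)))
    in a , e₀ ∷ e₁ ∷ es , step e₀ Xe₀ j₀ (step e₁ Xe₁ j₁ w) ,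
       ((e₀≢e₁ ∷ joins-avoids b∉ (joins-sym j₀) ends∈) ∷ joins-avoids b∉ j₁ ends∈ ∷ u) , λ ()
    where
    dᵇ : T (distinct (b ∷ c ∷ rest))
    dᵇ = distinct-tail a (b ∷ c ∷ rest) d
    dᶜ : T (distinct (c ∷ rest))
    dᶜ = distinct-tail b (c ∷ rest) dᵇ
    a∉ : a ∉ c ∷ rest
    a∉ = distinct-head a (b ∷ c ∷ rest) d ∘ there
    b∉ : b ∉ c ∷ rest ++ [ a ]
    b∉ b∈ with ∈-++⁻ (c ∷ rest) b∈
    ... | inj₁ b∈′ = distinct-head b (c ∷ rest) dᵇ b∈′
    ... | inj₂ (here refl) = distinct-head a (b ∷ c ∷ rest) d (here refl)

  cycle⇒closedTrail : T (hasCycle ends X) → ClosedTrail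
  cycle⇒closedTrail h with vs , 3≤ , d , c ← hasCycleOfLen≥⁻ 3 (adjIn ends X) h = from-list vs 3≤ d c
    where
    from-list : ∀ vs → 3 ≤ length vs → T (distinct vs) → T (closed (adjIn ends X) vs) → ClosedTrail
    from-list (a ∷ b ∷ c ∷ rest) _ = distinct-closed⇒closedTrail a b c rest
    from-list (_ ∷ _ ∷ []) (s≤s (s≤s ()))
    from-list (_ ∷ []) (s≤s ())
    from-list [] ()

without₀ : {m : ℕ} → List (Fin (suc m)) → List (Fin m)
without₀ [] = []
without₀ (zero ∷ es) = without₀ es
without₀ (suc e ∷ es) = e ∷ without₀ es

module _ {m : ℕ} {P : Fin (suc m) → Set} where

  All-without₀ : ∀ {es} → All P es → All (P ∘ suc) (without₀ es)
  All-without₀ [] = []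
  All-without₀ {zero ∷ es} (_ ∷ ps) = All-without₀ ps
  All-without₀ {suc e ∷ es} (p ∷ ps) = p ∷ All-without₀ ps

Unique-without₀ : {m : ℕ} {es : List (Fin (suc m))} → Unique es → Unique (without₀ es)
Unique-without₀ [] = []
Unique-without₀ {es = zero ∷ es} (_ ∷ u) = Unique-without₀ u
Unique-without₀ {es = suc e ∷ es} (e∉ ∷ u) =
  All.map (λ ne eq → ne (cong suc eq)) (All-without₀ e∉) ∷ Unique-without₀ u

isForest : {n m : ℕ} → (Fin m → Fin n × Fin n) → Vec Bool m → Bool
isForest ends []ᵥ = true
isForest ends (true ∷ᵥ X) = not (proj₁ (ends zero) == proj₂ (ends zero)) ∧ isForest (contract ends) X
isForest ends (false ∷ᵥ X) = isForest (ends ∘ suc) X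

module _ {n m : ℕ} {ends : Fin (suc m) → Fin n × Fin n} {X : Vec Bool m} where

  private
    u v : Fin n
    u = proj₁ (ends zero)
    v = proj₂ (ends zero)

  walk-deletion : ∀ {x y es} → Walk ends (false ∷ᵥ X) x y es → Walk (ends ∘ suc) X x y (without₀ es)
  walk-deletion [] = []
  walk-deletion (step (suc e) Xe j w) = step e Xe j (walk-deletion w)

  walk-contraction : ∀ {x y es} → Walk ends (true ∷ᵥ X) x y es →
                     Walk (contract ends) X (merge u v x) (merge u v y) (without₀ es)
  walk-contraction [] = []
  walk-contraction (step zero _ j w) rewrite joins-merge j = walk-contraction w
  walk-contraction (step (suc e) Xe j w) = step e Xe (joins-map (merge u v) j) (walk-contraction w)

  nonempty-deletion : ∀ {x y es} → Walk ends (false ∷ᵥ X) x y es → es ≢ [] → without₀ es ≢ []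
  nonempty-deletion [] ne = ⊥-elim (ne refl)
  nonempty-deletion (step (suc e) _ _ _) _ = λ ()

  nonempty-contraction : ∀ {x es} → u ≢ v → Walk ends (true ∷ᵥ X) x x es → Unique es →
                         es ≢ [] → without₀ es ≢ []
  nonempty-contraction _ [] _ ne = ⊥-elim (ne refl)
  nonempty-contraction u≢v (step zero _ j []) _ _ = ⊥-elim (u≢v (joins-loop j))
  nonempty-contraction _ (step zero _ _ (step zero _ _ _)) ((zero≢zero ∷ _) ∷ _) _ =
    ⊥-elim (zero≢zero refl)
  nonempty-contraction _ (step zero _ _ (step (suc e) _ _ _)) _ _ = λ ()
  nonempty-contraction _ (step (suc e) _ _ _) _ _ = λ ()

closedTrail⇒¬forest : ∀ {n m} (ends : Fin m → Fin n × Fin n) X →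
                      ClosedTrail ends X → ¬ T (isForest ends X)
closedTrail⇒¬forest ends []ᵥ (_ , [] , _ , _ , ne) _ = ne refl
closedTrail⇒¬forest ends (false ∷ᵥ X) (x , es , w , u , ne) =
  closedTrail⇒¬forest (ends ∘ suc) X
    (x , without₀ es , walk-deletion w , Unique-without₀ u , nonempty-deletion w ne)
closedTrail⇒¬forest ends (true ∷ᵥ X) (x , es , w , u , ne) h =
  let noLoop , h′ = to T-∧ h
  in closedTrail⇒¬forest (contract ends) X
       (_ , without₀ es , walk-contraction w , Unique-without₀ u ,
        nonempty-contraction (T-not⁻ noLoop ∘ ≡⇒==) w u ne) h′

-- Counting

𝟙 : Bool → ℕ
𝟙 true  = 1
𝟙 false = 0

countTrue-∷ : {A : Set} (p : A → Bool) (x : A) (xs : List A) →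
              countTrue p (x ∷ xs) ≡ 𝟙 (p x) + countTrue p xs
countTrue-∷ p x xs with p x
... | true  = refl
... | false = refl

module _ {A : Set} where

  countTrue-++ : ∀ (p : A → Bool) xs ys → countTrue p (xs ++ ys) ≡ countTrue p xs + countTrue p ys
  countTrue-++ p xs ys = trans (cong length (filter-++ (T? ∘ p) xs ys)) (length-++ (filterᵇ p xs))

  countTrue-map : ∀ {B : Set} (p : B → Bool) (f : A → B) xs →
                  countTrue p (map f xs) ≡ countTrue (p ∘ f) xs
  countTrue-map p f [] = refl
  countTrue-map p f (x ∷ xs) = begin
    countTrue p (f x ∷ map f xs)         ≡⟨ countTrue-∷ p (f x) (map f xs) ⟩
    𝟙 (p (f x)) + countTrue p (map f xs) ≡⟨ cong (𝟙 (p (f x)) +_) (countTrue-map p f xs) ⟩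
    𝟙 (p (f x)) + countTrue (p ∘ f) xs   ≡⟨ countTrue-∷ (p ∘ f) x xs ⟨
    countTrue (p ∘ f) (x ∷ xs)           ∎
    where open ≡-Reasoning

  countTrue-mono : ∀ {p q : A → Bool} xs → (∀ x → T (p x) → T (q x)) →
                   countTrue p xs ≤ countTrue q xs
  countTrue-mono [] _ = z≤n
  countTrue-mono {p} {q} (x ∷ xs) p⇒q with p x | q x | p⇒q x
  ... | true  | true  | _ = s≤s (countTrue-mono xs p⇒q)
  ... | true  | false | f = ⊥-elim (f _)
  ... | false | true  | _ = m≤n⇒m≤1+n (countTrue-mono xs p⇒q)
  ... | false | false | _ = countTrue-mono xs p⇒q

  countTrue-complement : ∀ (p : A → Bool) xs → countTrue p xs + countTrue (not ∘ p) xs ≡ length xs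
  countTrue-complement p [] = refl
  countTrue-complement p (x ∷ xs) with p x
  ... | true  = cong suc (countTrue-complement p xs)
  ... | false = trans (+-suc _ _) (cong suc (countTrue-complement p xs))

  countTrue-pointwise : ∀ {p q r s : A → Bool} xs →
                        (∀ x → 𝟙 (p x) + 𝟙 (q x) ≤ 𝟙 (r x) + 𝟙 (s x)) →
                        countTrue p xs + countTrue q xs ≤ countTrue r xs + countTrue s xs
  countTrue-pointwise [] _ = z≤n
  countTrue-pointwise {p} {q} {r} {s} (x ∷ xs) h = begin
    countTrue p (x ∷ xs) + countTrue q (x ∷ xs)
      ≡⟨ cong₂ _+_ (countTrue-∷ p x xs) (countTrue-∷ q x xs) ⟩
    (𝟙 (p x) + countTrue p xs) + (𝟙 (q x) + countTrue q xs)
      ≡⟨ interchange (𝟙 (p x)) _ _ _ ⟩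
    (𝟙 (p x) + 𝟙 (q x)) + (countTrue p xs + countTrue q xs)
      ≤⟨ +-mono-≤ (h x) (countTrue-pointwise xs h) ⟩
    (𝟙 (r x) + 𝟙 (s x)) + (countTrue r xs + countTrue s xs)
      ≡⟨ interchange (𝟙 (r x)) _ _ _ ⟩
    (𝟙 (r x) + countTrue r xs) + (𝟙 (s x) + countTrue s xs)
      ≡⟨ cong₂ _+_ (countTrue-∷ r x xs) (countTrue-∷ s x xs) ⟨
    countTrue r (x ∷ xs) + countTrue s (x ∷ xs) ∎
    where open ≤-Reasoning

  countTrue-∧-mono : ∀ b {p q : A → Bool} xs → countTrue p xs ≤ countTrue q xs →
                     countTrue (λ x → b ∧ p x) xs ≤ countTrue (λ x → b ∧ q x) xs
  countTrue-∧-mono true  xs h = h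
  countTrue-∧-mono false xs _ = countTrue-mono xs λ _ ()

countTrue-allBoolVecs : ∀ {m} (p : Vec Bool (suc m) → Bool) →
  countTrue p (allBoolVecs (suc m)) ≡
  countTrue (p ∘ (true ∷ᵥ_)) (allBoolVecs m) + countTrue (p ∘ (false ∷ᵥ_)) (allBoolVecs m)
countTrue-allBoolVecs {m} p = begin
  countTrue p (map (true ∷ᵥ_) V ++ map (false ∷ᵥ_) V ++ [])
    ≡⟨ countTrue-++ p (map (true ∷ᵥ_) V) _ ⟩
  countTrue p (map (true ∷ᵥ_) V) + countTrue p (map (false ∷ᵥ_) V ++ [])
    ≡⟨ cong (λ W → countTrue p (map (true ∷ᵥ_) V) + countTrue p W)
            (++-identityʳ (map (false ∷ᵥ_) V)) ⟩
  countTrue p (map (true ∷ᵥ_) V) + countTrue p (map (false ∷ᵥ_) V)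
    ≡⟨ cong₂ _+_ (countTrue-map p (true ∷ᵥ_) V) (countTrue-map p (false ∷ᵥ_) V) ⟩
  countTrue (p ∘ (true ∷ᵥ_)) V + countTrue (p ∘ (false ∷ᵥ_)) V ∎
  where
  open ≡-Reasoning
  V = allBoolVecs m

𝟙-deletion-contraction : ∀ a b c d → (T a → T d) → (T b → T d) → (T a → T b → T c) →
                         𝟙 a + 𝟙 b ≤ 𝟙 c + 𝟙 d
𝟙-deletion-contraction false false _     _     _  _  _   = z≤n
𝟙-deletion-contraction true  true  true  true  _  _  _   = ≤-refl
𝟙-deletion-contraction true  true  false _     _  _  abc = ⊥-elim (abc _ _)
𝟙-deletion-contraction true  b     c     false ad _  _   = ⊥-elim (ad _)
𝟙-deletion-contraction false true  c     false _  bd _   = ⊥-elim (bd _)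
𝟙-deletion-contraction true  false c     true  _  _  _   = m≤n+m 1 (𝟙 c)
𝟙-deletion-contraction false true  c     true  _  _  _   = m≤n+m 1 (𝟙 c)

acyclic-count≤forest-count : ∀ {n} m (ends : Fin m → Fin n × Fin n) →
  countTrue (acyclic ends) (allBoolVecs m) ≤ countTrue (isForest ends) (allBoolVecs m)
acyclic-count≤forest-count zero ends with acyclic ends []ᵥ
... | true  = ≤-refl
... | false = z≤n
acyclic-count≤forest-count (suc m) ends = begin
  countTrue (acyclic ends) (allBoolVecs (suc m))
    ≡⟨ countTrue-allBoolVecs (acyclic ends) ⟩
  countTrue (acyclic ends ∘ (true ∷ᵥ_)) V + countTrue (acyclic ends ∘ (false ∷ᵥ_)) V
    ≤⟨ countTrue-pointwise V (λ o → 𝟙-deletion-contraction _ _ _ _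
         (acyclic-deletion ends o true) (acyclic-deletion ends o false) (acyclic-contraction ends o)) ⟩
  countTrue (λ o → loopFree ∧ acyclic (contract ends) o) V + countTrue (acyclic (ends ∘ suc)) V
    ≤⟨ +-mono-≤ (countTrue-∧-mono loopFree V (acyclic-count≤forest-count m (contract ends)))
                (acyclic-count≤forest-count m (ends ∘ suc)) ⟩
  countTrue (λ X → loopFree ∧ isForest (contract ends) X) V + countTrue (isForest (ends ∘ suc)) V
    ≡⟨ countTrue-allBoolVecs (isForest ends) ⟨
  countTrue (isForest ends) (allBoolVecs (suc m)) ∎
  where
  open ≤-Reasoning
  V = allBoolVecs m
  loopFree = not (proj₁ (ends zero) == proj₂ (ends zero))

forest⇒no-cycle : ∀ {n m} (ends : Fin m → Fin n × Fin n) X →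
                  T (isForest ends X) → T (not (hasCycle ends X))
forest⇒no-cycle ends X forest =
  T-not⁺ λ c → closedTrail⇒¬forest ends X (cycle⇒closedTrail ends X c) forest

≤-from-complements : ∀ {a a′ b b′} → a + a′ ≡ b + b′ → b′ ≤ a′ → a ≤ b
≤-from-complements {a} {a′} {b} eq b′≤a′ =
  +-cancelʳ-≤ a′ a b (subst (_≤ b + a′) (sym eq) (+-monoʳ-≤ b b′≤a′))

mainTheorem8 : (n m : ℕ) (ends : Fin m → Fin n × Fin n) → IsSimple ends →
    countTrue (hasCycle ends) (allBoolVecs m) ≤ countTrue (hasDirectedCycle ends) (allBoolVecs m)
mainTheorem8 n m ends _ = ≤-from-complements
  (trans (countTrue-complement (hasCycle ends) V) (sym (countTrue-complement (hasDirectedCycle ends) V)))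
  (≤-trans (acyclic-count≤forest-count m ends) (countTrue-mono V (forest⇒no-cycle ends)))
  where
  V = allBoolVecs m
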